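{- Let $L < N \le 2L$ be positive integers and let $\boldsymbol\xi_1, \dots, \boldsymbol\xi_L$ be points of $E_N \cup F_N$. Then $$\|\boldsymbol\xi_1 \wedge \boldsymbol\xi_2 \wedge \cdots \wedge \boldsymbol\xi_L\|_1 \le \Bigl(\frac{N}{N-L}\Bigr)^{N-L}.$$
   Context: $E_N = \{\pm\boldsymbol e_m : 1\le m\le N\}$ and $F_N = \{\boldsymbol e_m - \boldsymbol e_n : 1\le m,n\le N,\ m\ne n\}$ with $\boldsymbol e_m$ the standard basis vectors of $\mathbb{R}^N$. With $\Xi$ the $N\times L$ matrix with columns $\boldsymbol\xi_\ell$ and $\Xi_I$ its submatrix of rows indexed by $I$, $\|\boldsymbol\xi_1\wedge\cdots\wedge\boldsymbol\xi_L\|_1 = \sum_{I\subseteq\{1,\dots,N\},|I|=L}|\det\Xi_I|$. -}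

module Defs where

open import Data.Nat using (ℕ; zero; suc)
open import Data.Fin using (Fin; zero; suc; punchIn; toℕ)
open import Data.Integer using (ℤ; +_; -_; _+_; _-_; _*_; ∣_∣)
open import Data.List using (List; []; _∷_; map; _++_)
open import Data.Nat.ListAction using (sum)
open import Data.Vec using (Vec; []; _∷_; lookup)
import Data.Vec as V
open import Data.Product using (Σ; ∃; _×_)
open import Data.Sum using (_⊎_)
open import Relation.Binary.PropositionalEquality using (_≡_; _≢_)
open import Relation.Nullary.Decidable using (does)
open import Data.Fin.Properties using (_≟_)
open import Data.Bool using (if_then_else_)

e : {N : ℕ} → Fin N → Fin N → ℤ
e m j = if does (m ≟ j) then + 1 else + 0

InE : {N : ℕ} → (Fin N → ℤ) → Set
InE {N} ξ = Σ (Fin N) λ m → (∀ j → ξ j ≡ e m j) ⊎ (∀ j → ξ j ≡ - e m j)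

InF : {N : ℕ} → (Fin N → ℤ) → Set
InF {N} ξ = Σ (Fin N) λ m → Σ (Fin N) λ n → m ≢ n × (∀ j → ξ j ≡ e m j - e n j)

sumFin : (n : ℕ) → (Fin n → ℤ) → ℤ
sumFin zero f = + 0
sumFin (suc n) f = f zero + sumFin n (λ i → f (suc i))

sgn : ℕ → ℤ
sgn zero = + 1
sgn (suc k) = - sgn k

-- determinant of an n×n integer matrix (A r c = entry in row r, column c),
-- by Laplace expansion along the first column
det : (n : ℕ) → (Fin n → Fin n → ℤ) → ℤ
det zero A = + 1
det (suc n) A =
  sumFin (suc n) λ i → sgn (toℕ i) * A i zero * det n (λ r c → A (punchIn i r) (suc c))

-- all k-element subsets of {0..n-1}, each as its strictly increasing list of elements
combs : (k n : ℕ) → List (Vec (Fin n) k)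
combs zero n = [] ∷ []
combs (suc k) zero = []
combs (suc k) (suc n) =
  map (λ v → zero ∷ V.map suc v) (combs k n) ++ map (V.map suc) (combs (suc k) n)

-- ‖ξ_1 ∧ ... ∧ ξ_L‖_1 = Σ_{|I| = L} |det Ξ_I|, where Ξ has columns ξ_ℓ
-- and Ξ_I is the L×L submatrix with rows indexed by I
wedgeNorm1 : (N L : ℕ) → (Fin L → Fin N → ℤ) → ℕ
wedgeNorm1 N L ξ =
  sum (map (λ I → ∣ det L (λ r c → ξ c (lookup I r)) ∣) (combs L N))

-- Give row j of Ξ a weight w_j ≥ 0 and prove, for every L ≤ N, the weighted bound
--   (∑_{|I| = L} |det Ξ_I| ∏_{j ∉ I} w_j) (N - L)^(N - L) ≤ (∑_j w_j)^(N - L)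
-- for all Ξ whose columns have the form u - v with u, v ∈ {0, e_1, …, e_N}; unit
-- weights give the theorem.  The induction on L expands along the first column.  A zero
-- column makes every minor vanish.  A column ±e_m deletes row m: only subsets containing
-- m contribute, leaving the same problem for L - 1 columns, N - 1 rows and smaller total
-- weight.  A column e_a - e_b becomes -e_b after adding row b to row a, which does not
-- change the minors containing b; the subsets avoiding b then see the column e_a, and the
-- two parts combine into the problem with rows a and b merged into one row of weight
-- w_a + w_b, so the total weight is unchanged.  For L = 0 the bound is AM-GM.

module Submission where

module Determinant where

  open import Data.Nat.Base using (ℕ; zero; suc)
  open import Data.Integer.Base using (ℤ; +_; -_; _+_; _-_; _*_)
  open import Data.Integer.Properties using (+-identityˡ; +-identityʳ; +-0-abelianGroup)
  open import Algebra.Properties.AbelianGroup +-0-abelianGroup using (inverseˡ-unique)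
  open import Data.Integer.Tactic.RingSolver using (solve-∀)
  open import Data.List.Base using (List; []; _∷_; [_]; map; _++_; length)
  open import Data.List.Properties using (++-assoc; map-++)
  open import Data.List.Relation.Unary.All using (All; []; _∷_)
  open import Data.List.Relation.Binary.Pointwise using (Pointwise; []; _∷_)
  open import Data.Vec.Functional using (Vector; head; tail; zipWith)
  open import Data.Sum.Base using (_⊎_; inj₁; inj₂)
  open import Relation.Binary.PropositionalEquality using (_≡_; refl; sym; trans; cong₂; module ≡-Reasoning)
  open import Defs using (sgn)

  Row : ℕ → Set
  Row = Vector ℤ

  _⊕_ : ∀ {n} → Row n → Row n → Row n
  _⊕_ = zipWith _+_

  -- laplace n done rest is the contribution of the rows rest to the expansion along the
  -- first column, up to the sign (-1)^(length done); done holds the tails of the rows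
  -- already passed, which enter every remaining minor.
  mutual
    detRows : (n : ℕ) → List (Row n) → ℤ
    detRows zero    []      = + 1
    detRows zero    (_ ∷ _) = + 0
    detRows (suc n) rows    = laplace n [] rows

    laplace : (n : ℕ) → List (Row n) → List (Row (suc n)) → ℤ
    laplace n done []         = + 0
    laplace n done (r ∷ rest) =
      head r * detRows n (done ++ map tail rest) - laplace n (done ++ [ tail r ]) rest

  ++-snoc : ∀ {A : Set} (xs : List A) y zs → (xs ++ [ y ]) ++ zs ≡ xs ++ y ∷ zs
  ++-snoc xs y zs = ++-assoc xs [ y ] zs

  ++-cons-assoc : ∀ {A : Set} (xs : List A) y ys zs → (xs ++ y ∷ ys) ++ zs ≡ xs ++ y ∷ ys ++ zs
  ++-cons-assoc xs y ys zs = ++-assoc xs (y ∷ ys) zs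

  private
    distribute-expansion : ∀ (x d₁ d₂ e₁ e₂ : ℤ) →
      x * (d₁ + d₂) - (e₁ + e₂) ≡ (x * d₁ - e₁) + (x * d₂ - e₂)
    distribute-expansion = solve-∀

    distribute-expansion′ : ∀ (x y d e₁ e₂ : ℤ) →
      (x + y) * d - (e₁ + e₂) ≡ (x * d - e₁) + (y * d - e₂)
    distribute-expansion′ = solve-∀

    zero-minor : ∀ (h : ℤ) → h * + 0 - + 0 ≡ + 0
    zero-minor = solve-∀

    equal-terms : ∀ (h d : ℤ) → h * d - (h * d - + 0) ≡ + 0
    equal-terms = solve-∀

  mutual
    detRows-additive : ∀ n A B (r s : Row n) →
      detRows n (A ++ r ⊕ s ∷ B) ≡ detRows n (A ++ r ∷ B) + detRows n (A ++ s ∷ B)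
    detRows-additive zero    []      B r s = refl
    detRows-additive zero    (_ ∷ A) B r s = refl
    detRows-additive (suc n) A       B r s = laplace-additive-rest n [] A B r s

    laplace-additive-done : ∀ n P Q rest (r s : Row n) →
      laplace n (P ++ r ⊕ s ∷ Q) rest ≡ laplace n (P ++ r ∷ Q) rest + laplace n (P ++ s ∷ Q) rest
    laplace-additive-done n P Q []       r s = refl
    laplace-additive-done n P Q (x ∷ xs) r s
      rewrite ++-cons-assoc P (r ⊕ s) Q (map tail xs) | ++-cons-assoc P r Q (map tail xs)
            | ++-cons-assoc P s Q (map tail xs)
            | ++-cons-assoc P (r ⊕ s) Q [ tail x ] | ++-cons-assoc P r Q [ tail x ]
            | ++-cons-assoc P s Q [ tail x ]
            | detRows-additive n P (Q ++ map tail xs) r s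
            | laplace-additive-done n P (Q ++ [ tail x ]) xs r s
      = distribute-expansion (head x) _ _ _ _

    laplace-additive-rest : ∀ n done A B (r s : Row (suc n)) →
      laplace n done (A ++ r ⊕ s ∷ B) ≡ laplace n done (A ++ r ∷ B) + laplace n done (A ++ s ∷ B)
    laplace-additive-rest n done [] B r s
      rewrite laplace-additive-done n done [] B (tail r) (tail s)
      = distribute-expansion′ (head r) (head s) _ _ _
    laplace-additive-rest n done (a ∷ A) B r s
      rewrite map-++ tail A (r ⊕ s ∷ B) | map-++ tail A (r ∷ B) | map-++ tail A (s ∷ B)
            | sym (++-assoc done (map tail A) (tail (r ⊕ s) ∷ map tail B))
            | sym (++-assoc done (map tail A) (tail r ∷ map tail B))
            | sym (++-assoc done (map tail A) (tail s ∷ map tail B))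
            | detRows-additive n (done ++ map tail A) (map tail B) (tail r) (tail s)
            | laplace-additive-rest n (done ++ [ tail a ]) A B r s
      = distribute-expansion (head a) _ _ _ _

  mutual
    detRows-adjacent-equal : ∀ n A B (x : Row n) → detRows n (A ++ x ∷ x ∷ B) ≡ + 0
    detRows-adjacent-equal zero    []      B x = refl
    detRows-adjacent-equal zero    (_ ∷ A) B x = refl
    detRows-adjacent-equal (suc n) A       B x = laplace-adjacent-equal-rest n [] A B x

    laplace-adjacent-equal-done : ∀ n P Q (y : Row n) rest → laplace n (P ++ y ∷ y ∷ Q) rest ≡ + 0
    laplace-adjacent-equal-done n P Q y []       = refl
    laplace-adjacent-equal-done n P Q y (x ∷ xs)
      rewrite ++-cons-assoc P y (y ∷ Q) (map tail xs) | ++-cons-assoc P y (y ∷ Q) [ tail x ]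
            | detRows-adjacent-equal n P (Q ++ map tail xs) y
            | laplace-adjacent-equal-done n P (Q ++ [ tail x ]) y xs
      = zero-minor (head x)

    -- the two adjacent equal rows contribute equal terms of opposite sign
    laplace-adjacent-equal-rest : ∀ n done A B (x : Row (suc n)) → laplace n done (A ++ x ∷ x ∷ B) ≡ + 0
    laplace-adjacent-equal-rest n done [] B x
      rewrite ++-snoc done (tail x) (map tail B) | ++-snoc done (tail x) [ tail x ]
            | laplace-adjacent-equal-done n done [] (tail x) B
      = equal-terms (head x) _
    laplace-adjacent-equal-rest n done (a ∷ A) B x
      rewrite map-++ tail A (x ∷ x ∷ B)
            | sym (++-assoc done (map tail A) (tail x ∷ tail x ∷ map tail B))
            | detRows-adjacent-equal n (done ++ map tail A) (map tail B) (tail x)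
            | laplace-adjacent-equal-rest n (done ++ [ tail a ]) A B x
      = zero-minor (head a)

  detRows-swap : ∀ n A B (x y : Row n) → detRows n (A ++ x ∷ y ∷ B) ≡ - detRows n (A ++ y ∷ x ∷ B)
  detRows-swap n A B x y =
    antisymmetric (detRows-adjacent-equal n A B x) (detRows-adjacent-equal n A B y) (begin
      + 0                                       ≡⟨ sym (detRows-adjacent-equal n A B (x ⊕ y)) ⟩
      detRows n (A ++ x ⊕ y ∷ x ⊕ y ∷ B)        ≡⟨ detRows-additive n A (x ⊕ y ∷ B) x y ⟩
      detRows n (A ++ x ∷ x ⊕ y ∷ B) + detRows n (A ++ y ∷ x ⊕ y ∷ B)
        ≡⟨ cong₂ _+_ (additive-second x) (additive-second y) ⟩
      (detRows n (A ++ x ∷ x ∷ B) + detRows n (A ++ x ∷ y ∷ B)) +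
      (detRows n (A ++ y ∷ x ∷ B) + detRows n (A ++ y ∷ y ∷ B)) ∎)
    where
    open ≡-Reasoning
    additive-second : ∀ u →
      detRows n (A ++ u ∷ x ⊕ y ∷ B) ≡ detRows n (A ++ u ∷ x ∷ B) + detRows n (A ++ u ∷ y ∷ B)
    additive-second u
      rewrite sym (++-snoc A u (x ⊕ y ∷ B)) | sym (++-snoc A u (x ∷ B)) | sym (++-snoc A u (y ∷ B))
      = detRows-additive n (A ++ [ u ]) B x y
    antisymmetric : ∀ {xx xy yx yy : ℤ} → xx ≡ + 0 → yy ≡ + 0 → + 0 ≡ (xx + xy) + (yx + yy) → xy ≡ - yx
    antisymmetric {xy = xy} {yx} refl refl sum≡0 = inverseˡ-unique xy yx
      (trans (cong₂ _+_ (sym (+-identityˡ xy)) (sym (+-identityʳ yx))) (sym sum≡0))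

  detRows-repeated-row : ∀ n A B C (x : Row n) → detRows n (A ++ x ∷ B ++ x ∷ C) ≡ + 0
  detRows-repeated-row n A []      C x = detRows-adjacent-equal n A C x
  detRows-repeated-row n A (b ∷ B) C x
    rewrite detRows-swap n A (B ++ x ∷ C) x b | sym (++-snoc A b (x ∷ B ++ x ∷ C))
          | detRows-repeated-row n (A ++ [ b ]) B C x
    = refl

  detRows-add-later-row : ∀ n A B C (r s : Row n) →
    detRows n (A ++ r ⊕ s ∷ B ++ s ∷ C) ≡ detRows n (A ++ r ∷ B ++ s ∷ C)
  detRows-add-later-row n A B C r s
    rewrite detRows-additive n A (B ++ s ∷ C) r s | detRows-repeated-row n A B C s
    = +-identityʳ _

  detRows-add-earlier-row : ∀ n A B C (r s : Row n) →
    detRows n (A ++ s ∷ B ++ r ⊕ s ∷ C) ≡ detRows n (A ++ s ∷ B ++ r ∷ C)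
  detRows-add-earlier-row n A B C r s
    rewrite sym (++-cons-assoc A s B (r ⊕ s ∷ C)) | sym (++-cons-assoc A s B (r ∷ C))
          | detRows-additive n (A ++ s ∷ B) C r s
          | ++-cons-assoc A s B (s ∷ C) | detRows-repeated-row n A B C s
    = +-identityʳ _

  AddedOrKept : ∀ {n} → Row n → Row n → Row n → Set
  AddedOrKept s x y = x ≡ y ⊎ x ≡ y ⊕ s

  detRows-add-to-later-rows : ∀ n (s : Row n) P Q {Y Y′} → Pointwise (AddedOrKept s) Y Y′ →
    detRows n (P ++ s ∷ Q ++ Y) ≡ detRows n (P ++ s ∷ Q ++ Y′)
  detRows-add-to-later-rows n s P Q []                         = refl
  detRows-add-to-later-rows n s P Q {y ∷ Y} {y ∷ Y′} (inj₁ refl ∷ Y~Y′)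
    rewrite sym (++-snoc Q y Y) | sym (++-snoc Q y Y′)
    = detRows-add-to-later-rows n s P (Q ++ [ y ]) Y~Y′
  detRows-add-to-later-rows n s P Q {_ ∷ Y} {y ∷ Y′} (inj₂ refl ∷ Y~Y′)
    rewrite detRows-add-earlier-row n P Q Y y s | sym (++-snoc Q y Y) | sym (++-snoc Q y Y′)
    = detRows-add-to-later-rows n s P (Q ++ [ y ]) Y~Y′

  detRows-add-to-earlier-rows : ∀ n (s : Row n) P {X X′} Y → Pointwise (AddedOrKept s) X X′ →
    detRows n (P ++ X ++ s ∷ Y) ≡ detRows n (P ++ X′ ++ s ∷ Y)
  detRows-add-to-earlier-rows n s P Y []                         = refl
  detRows-add-to-earlier-rows n s P {x ∷ X} {x ∷ X′} Y (inj₁ refl ∷ X~X′)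
    rewrite sym (++-snoc P x (X ++ s ∷ Y)) | sym (++-snoc P x (X′ ++ s ∷ Y))
    = detRows-add-to-earlier-rows n s (P ++ [ x ]) Y X~X′
  detRows-add-to-earlier-rows n s P {_ ∷ X} {x ∷ X′} Y (inj₂ refl ∷ X~X′)
    rewrite detRows-add-later-row n P X Y x s
          | sym (++-snoc P x (X ++ s ∷ Y)) | sym (++-snoc P x (X′ ++ s ∷ Y))
    = detRows-add-to-earlier-rows n s (P ++ [ x ]) Y X~X′

  detRows-add-to-other-rows : ∀ n (s : Row n) {X X′ Y Y′} →
    Pointwise (AddedOrKept s) X X′ → Pointwise (AddedOrKept s) Y Y′ →
    detRows n (X ++ s ∷ Y) ≡ detRows n (X′ ++ s ∷ Y′)
  detRows-add-to-other-rows n s {Y = Y} X~X′ Y~Y′ =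
    trans (detRows-add-to-earlier-rows n s [] Y X~X′) (detRows-add-to-later-rows n s _ [] Y~Y′)

  HeadZero : ∀ {n} → Row (suc n) → Set
  HeadZero r = head r ≡ + 0

  laplace-zero-column : ∀ n done rest → All HeadZero rest → laplace n done rest ≡ + 0
  laplace-zero-column n done []       []         = refl
  laplace-zero-column n done (r ∷ rs) (r₀ ∷ rs₀)
    rewrite r₀ | laplace-zero-column n (done ++ [ tail r ]) rs rs₀
    = refl

  detRows-zero-column : ∀ n rows → All HeadZero rows → detRows (suc n) rows ≡ + 0
  detRows-zero-column n = laplace-zero-column n []

  laplace-single-nonzero : ∀ n done A r B → All HeadZero A → All HeadZero B →
    laplace n done (A ++ r ∷ B) ≡ sgn (length A) * (head r * detRows n (done ++ map tail A ++ map tail B))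
  laplace-single-nonzero n done [] r B [] B₀
    rewrite laplace-zero-column n (done ++ [ tail r ]) B B₀
    = sign-one (head r) _
    where
    sign-one : ∀ (h d : ℤ) → h * d - + 0 ≡ + 1 * (h * d)
    sign-one = solve-∀
  laplace-single-nonzero n done (a ∷ A) r B (a₀ ∷ A₀) B₀
    rewrite a₀ | laplace-single-nonzero n (done ++ [ tail a ]) A r B A₀ B₀
          | ++-snoc done (tail a) (map tail A ++ map tail B)
    = sign-flip (sgn (length A)) (head r) _ (detRows n (done ++ map tail (A ++ r ∷ B)))
    where
    sign-flip : ∀ (σ h d d′ : ℤ) → + 0 * d′ - σ * (h * d) ≡ (- σ) * (h * d)
    sign-flip = solve-∀

module SubsetSum where

  open import Data.Nat.Base using (ℕ; zero; suc; _+_; _*_)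
  open import Data.Nat.Properties
    using (*-zeroʳ; +-identityʳ; *-distribʳ-+; *-commutativeSemigroup; *-1-commutativeMonoid)
  open import Algebra.Properties.CommutativeSemigroup *-commutativeSemigroup using (x∙yz≈y∙xz)
  open import Data.Nat.Tactic.RingSolver using (solve-∀)
  open import Data.Fin.Base as Fin using (Fin; zero; suc; punchIn)
  open import Data.Fin.Properties using (_≟_; punchInᵢ≢i)
  open import Data.Product.Base using (Σ; _,_)
  open import Data.List.Base using (List; []; _∷_; map; _++_)
  open import Data.List.Properties using (map-++; map-∘)
  open import Data.Vec.Functional using (Vector; head; tail; removeAt; updateAt)
  open import Data.Vec.Functional.Properties using (updateAt-updates; updateAt-minimal)
  open import Data.Bool.Base using (Bool; true; false; if_then_else_; _∨_)
  open import Function.Base using (_∘_)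
  open import Relation.Nullary.Decidable using (does; yes; no)
  open import Relation.Binary.PropositionalEquality
    using (_≡_; _≗_; refl; sym; trans; cong; cong₂; module ≡-Reasoning)
  open import Algebra.Properties.CommutativeMonoid.Sum *-1-commutativeMonoid
    using () renaming (sum to product; sum-cong-≗ to product-cong; sum-remove to product-remove)

  -- subsetSum k n w F = ∑_{I ⊆ {0,…,n-1}, |I| = k} F I * ∏_{j ∉ I} w j,
  -- where I is passed to F as the increasing list of its elements.
  subsetSum : (k n : ℕ) → Vector ℕ n → (List (Fin n) → ℕ) → ℕ
  subsetSum zero    n       w F = F [] * product w
  subsetSum (suc k) zero    w F = 0
  subsetSum (suc k) (suc n) w F =
    subsetSum k n (tail w) (F ∘ (zero ∷_) ∘ map suc) + head w * subsetSum (suc k) n (tail w) (F ∘ map suc)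

  subsetSum-cong : ∀ k n w {F G} → F ≗ G → subsetSum k n w F ≡ subsetSum k n w G
  subsetSum-cong zero    n       w F≗G = cong (_* product w) (F≗G [])
  subsetSum-cong (suc k) zero    w F≗G = refl
  subsetSum-cong (suc k) (suc n) w F≗G =
    cong₂ _+_ (subsetSum-cong k n (tail w) (F≗G ∘ _))
              (cong (head w *_) (subsetSum-cong (suc k) n (tail w) (F≗G ∘ _)))

  subsetSum-cong-weights : ∀ k n {w w′} F → w ≗ w′ → subsetSum k n w F ≡ subsetSum k n w′ F
  subsetSum-cong-weights zero    n       F w≗w′ = cong (F [] *_) (product-cong w≗w′)
  subsetSum-cong-weights (suc k) zero    F w≗w′ = refl
  subsetSum-cong-weights (suc k) (suc n) F w≗w′ =
    cong₂ _+_ (subsetSum-cong-weights k n _ (w≗w′ ∘ suc))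
              (cong₂ _*_ (w≗w′ zero) (subsetSum-cong-weights (suc k) n _ (w≗w′ ∘ suc)))

  subsetSum-const-zero : ∀ k n w → subsetSum k n w (λ _ → 0) ≡ 0
  subsetSum-const-zero zero    n       w = refl
  subsetSum-const-zero (suc k) zero    w = refl
  subsetSum-const-zero (suc k) (suc n) w
    rewrite subsetSum-const-zero k n (tail w) | subsetSum-const-zero (suc k) n (tail w)
    = *-zeroʳ (head w)

  subsetSum-zero : ∀ k n w F → (∀ I → F I ≡ 0) → subsetSum k n w F ≡ 0
  subsetSum-zero k n w F F≡0 = trans (subsetSum-cong k n w F≡0) (subsetSum-const-zero k n w)

  subsetSum-+ : ∀ k n w F G → subsetSum k n w (λ I → F I + G I) ≡ subsetSum k n w F + subsetSum k n w G
  subsetSum-+ zero    n       w F G = *-distribʳ-+ (product w) (F []) (G [])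
  subsetSum-+ (suc k) zero    w F G = refl
  subsetSum-+ (suc k) (suc n) w F G
    rewrite subsetSum-+ k n (tail w) (F ∘ (zero ∷_) ∘ map suc) (G ∘ (zero ∷_) ∘ map suc)
          | subsetSum-+ (suc k) n (tail w) (F ∘ map suc) (G ∘ map suc)
    = interchange (head w) (subsetSum k n (tail w) (F ∘ (zero ∷_) ∘ map suc))
        (subsetSum k n (tail w) (G ∘ (zero ∷_) ∘ map suc))
        (subsetSum (suc k) n (tail w) (F ∘ map suc)) (subsetSum (suc k) n (tail w) (G ∘ map suc))
    where
    interchange : ∀ h a b c d → (a + b) + h * (c + d) ≡ (a + h * c) + (b + h * d)
    interchange = solve-∀

  _∈ᵇ_ : ∀ {n} → Fin n → List (Fin n) → Bool
  x ∈ᵇ []      = false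
  x ∈ᵇ (y ∷ I) = does (x ≟ y) ∨ x ∈ᵇ I

  containing avoiding : ∀ {n} → Fin n → (List (Fin n) → ℕ) → List (Fin n) → ℕ
  containing x F I = if x ∈ᵇ I then F I else 0
  avoiding   x F I = if x ∈ᵇ I then 0 else F I

  subsetSum-split : ∀ k n w x F →
    subsetSum k n w F ≡ subsetSum k n w (containing x F) + subsetSum k n w (avoiding x F)
  subsetSum-split k n w x F = trans (subsetSum-cong k n w split) (subsetSum-+ k n w _ _)
    where
    split : ∀ I → F I ≡ containing x F I + avoiding x F I
    split I with x ∈ᵇ I
    ... | true  = sym (+-identityʳ (F I))
    ... | false = refl

  ∈ᵇ-split : ∀ {n} (b : Fin n) I → b ∈ᵇ I ≡ true →
    Σ (List (Fin n)) λ P → Σ (List (Fin n)) λ Q → I ≡ P ++ b ∷ Q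
  ∈ᵇ-split b (y ∷ I) b∈I with b ≟ y
  ... | yes refl = [] , I , refl
  ... | no _ with P , Q , refl ← ∈ᵇ-split b I b∈I = y ∷ P , Q , refl

  suc-∈ᵇ-map-suc : ∀ {n} (x : Fin n) J → suc x ∈ᵇ map suc J ≡ x ∈ᵇ J
  suc-∈ᵇ-map-suc x []      = refl
  suc-∈ᵇ-map-suc x (y ∷ J) = cong (does (x ≟ y) ∨_) (suc-∈ᵇ-map-suc x J)

  zero-∉ᵇ-map-suc : ∀ {n} J → zero ∈ᵇ map (suc {n}) J ≡ false
  zero-∉ᵇ-map-suc []      = refl
  zero-∉ᵇ-map-suc (y ∷ J) = zero-∉ᵇ-map-suc J

  containing-suc : ∀ {n} (x : Fin n) F J → containing (suc x) F (map suc J) ≡ containing x (F ∘ map suc) J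
  containing-suc x F J rewrite suc-∈ᵇ-map-suc x J = refl

  avoiding-suc : ∀ {n} (x : Fin n) F J → avoiding (suc x) F (map suc J) ≡ avoiding x (F ∘ map suc) J
  avoiding-suc x F J rewrite suc-∈ᵇ-map-suc x J = refl

  containing-zero-map-suc : ∀ {n} F J → containing {suc n} zero F (map suc J) ≡ 0
  containing-zero-map-suc F J rewrite zero-∉ᵇ-map-suc J = refl

  avoiding-zero-map-suc : ∀ {n} F J → avoiding {suc n} zero F (map suc J) ≡ F (map suc J)
  avoiding-zero-map-suc F J rewrite zero-∉ᵇ-map-suc J = refl

  map-punchIn-suc : ∀ {n} (x : Fin (suc n)) J →
    map (punchIn (suc x)) (map suc J) ≡ map suc (map (punchIn x) J)
  map-punchIn-suc x J = trans (sym (map-∘ J)) (map-∘ J)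

  -- G is F restricted to the subsets containing x, with x deleted and the other
  -- elements renumbered; x may sit anywhere in the list handed to F.
  DeletionOf : ∀ {n} → Fin (suc n) → (List (Fin (suc n)) → ℕ) → (List (Fin n) → ℕ) → Set
  DeletionOf x F G = ∀ A B → F (map (punchIn x) A ++ x ∷ map (punchIn x) B) ≡ G (A ++ B)

  deletionOf-suc : ∀ {n} (x : Fin (suc n)) F G → DeletionOf (suc x) F G →
    DeletionOf x (F ∘ map suc) (G ∘ map suc)
  deletionOf-suc {n} x F G del A B
    rewrite map-++ (Fin.suc {suc n}) (map (punchIn x) A) (x ∷ map (punchIn x) B)
          | map-++ (Fin.suc {n}) A B | sym (map-punchIn-suc x A) | sym (map-punchIn-suc x B)
    = del (map suc A) (map suc B)

  subsetSum-containing : ∀ k n w (x : Fin (suc n)) F G → DeletionOf x F G →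
    subsetSum (suc k) (suc n) w (containing x F) ≡ subsetSum k n (removeAt w x) G
  subsetSum-containing k n w zero F G del
    rewrite subsetSum-zero (suc k) n (tail w) _ (containing-zero-map-suc F) | *-zeroʳ (head w)
          | +-identityʳ (subsetSum k n (tail w) (containing zero F ∘ (zero ∷_) ∘ map suc))
    = subsetSum-cong k n (tail w) (del [])
  subsetSum-containing zero (suc n) w (suc x) F G del
    rewrite subsetSum-cong 1 (suc n) (tail w) (containing-suc x F)
          | subsetSum-containing zero n (tail w) x (F ∘ map suc) (G ∘ map suc) (deletionOf-suc x F G del)
    = x∙yz≈y∙xz (head w) (G []) (product (removeAt (tail w) x))
  subsetSum-containing (suc k) (suc n) w (suc x) F G del
    rewrite subsetSum-cong (suc k) (suc n) (tail w) (containing-suc x (λ I → F (zero ∷ I)))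
          | subsetSum-containing k n (tail w) x (λ J → F (zero ∷ map suc J)) (λ J → G (zero ∷ map suc J))
              (deletionOf-suc x (F ∘ (zero ∷_)) (G ∘ (zero ∷_)) λ A B → del (zero ∷ A) B)
          | subsetSum-cong (suc (suc k)) (suc n) (tail w) (containing-suc x F)
          | subsetSum-containing (suc k) n (tail w) x (F ∘ map suc) (G ∘ map suc) (deletionOf-suc x F G del)
    = refl

  subsetSum-avoiding : ∀ k n w (x : Fin (suc n)) F →
    subsetSum k (suc n) w (avoiding x F) ≡ w x * subsetSum k n (removeAt w x) (F ∘ map (punchIn x))
  subsetSum-avoiding zero n w x F =
    trans (cong (F [] *_) (product-remove w)) (x∙yz≈y∙xz (F []) (w x) (product (removeAt w x)))
  subsetSum-avoiding (suc k) n w zero F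
    rewrite subsetSum-zero k n (tail w) (avoiding zero F ∘ (zero ∷_) ∘ map suc) (λ _ → refl)
          | subsetSum-cong (suc k) n (tail w) (avoiding-zero-map-suc F)
    = refl
  subsetSum-avoiding (suc k) (suc n) w (suc x) F
    rewrite subsetSum-cong k (suc n) (tail w) (avoiding-suc x (λ I → F (zero ∷ I)))
          | subsetSum-avoiding k n (tail w) x (λ J → F (zero ∷ map suc J))
          | subsetSum-cong (suc k) (suc n) (tail w) (avoiding-suc x F)
          | subsetSum-avoiding (suc k) n (tail w) x (F ∘ map suc)
          | subsetSum-cong k n (removeAt (tail w) x) {λ J → F (zero ∷ map suc (map (punchIn x) J))}
              (λ J → cong (λ L → F (zero ∷ L)) (sym (map-punchIn-suc x J)))
          | subsetSum-cong (suc k) n (removeAt (tail w) x) {λ J → F (map suc (map (punchIn x) J))}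
              (λ J → cong F (sym (map-punchIn-suc x J)))
    = factor-out (w (suc x)) _ (head w) _
    where
    factor-out : ∀ a b c d → a * b + c * (a * d) ≡ a * (b + c * d)
    factor-out = solve-∀

  subsetSum-containing-cong-weights : ∀ k n w w′ (x : Fin (suc n)) F →
    removeAt w x ≗ removeAt w′ x →
    subsetSum k (suc n) w (containing x F) ≡ subsetSum k (suc n) w′ (containing x F)
  subsetSum-containing-cong-weights zero    n       w w′ x       F w≗w′ = refl
  subsetSum-containing-cong-weights (suc k) n       w w′ zero    F w≗w′
    rewrite subsetSum-zero (suc k) n (tail w) _ (containing-zero-map-suc F)
          | subsetSum-zero (suc k) n (tail w′) _ (containing-zero-map-suc F)
          | *-zeroʳ (head w) | *-zeroʳ (head w′)
    = cong (_+ 0) (subsetSum-cong-weights k n _ w≗w′)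
  subsetSum-containing-cong-weights (suc k) (suc n) w w′ (suc x) F w≗w′
    rewrite subsetSum-cong k (suc n) (tail w) (containing-suc x (λ I → F (zero ∷ I)))
          | subsetSum-cong k (suc n) (tail w′) (containing-suc x (λ I → F (zero ∷ I)))
          | subsetSum-containing-cong-weights k n (tail w) (tail w′) x (λ J → F (zero ∷ map suc J))
              (w≗w′ ∘ suc)
          | subsetSum-cong (suc k) (suc n) (tail w) (containing-suc x F)
          | subsetSum-cong (suc k) (suc n) (tail w′) (containing-suc x F)
          | subsetSum-containing-cong-weights (suc k) n (tail w) (tail w′) x (F ∘ map suc) (w≗w′ ∘ suc)
          | w≗w′ zero
    = refl

  subsetSum-increase-weight : ∀ k n w (x : Fin (suc n)) d F →
    subsetSum k (suc n) (updateAt w x (_+ d)) F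
      ≡ subsetSum k (suc n) w F + d * subsetSum k n (removeAt w x) (F ∘ map (punchIn x))
  subsetSum-increase-weight k n w x d F = begin
    subsetSum k (suc n) w′ F
      ≡⟨ subsetSum-split k (suc n) w′ x F ⟩
    subsetSum k (suc n) w′ (containing x F) + subsetSum k (suc n) w′ (avoiding x F)
      ≡⟨ cong₂ _+_ (subsetSum-containing-cong-weights k n w′ w x F elsewhere) (subsetSum-avoiding k n w′ x F) ⟩
    S∋ + w′ x * subsetSum k n (removeAt w′ x) F∌
      ≡⟨ cong₂ (λ u v → S∋ + u * v) (updateAt-updates x w) (subsetSum-cong-weights k n F∌ elsewhere) ⟩
    S∋ + (w x + d) * S∌
      ≡⟨ regroup S∋ (w x) d S∌ ⟩
    (S∋ + w x * S∌) + d * S∌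
      ≡⟨ cong (λ t → t + d * S∌) (sym (trans (subsetSum-split k (suc n) w x F)
                                               (cong (S∋ +_) (subsetSum-avoiding k n w x F)))) ⟩
    subsetSum k (suc n) w F + d * S∌ ∎
    where
    open ≡-Reasoning
    w′ = updateAt w x (_+ d)
    F∌ = F ∘ map (punchIn x)
    S∋ = subsetSum k (suc n) w (containing x F)
    S∌ = subsetSum k n (removeAt w x) F∌
    elsewhere : removeAt w′ x ≗ removeAt w x
    elsewhere i = updateAt-minimal (punchIn x i) x w (punchInᵢ≢i x i)
    regroup : ∀ a b c d → a + (b + c) * d ≡ (a + b * d) + c * d
    regroup = solve-∀

module AMGM where

  open import Data.Nat.Base using (ℕ; zero; suc; _+_; _*_; _^_; _≤_; NonZero)
  open import Data.Nat.Properties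
    using (≤-total; *-comm; +-comm; ≤-reflexive; m≤n⇒∃[o]m+o≡n; m≤m+n;
           *-monoˡ-≤; *-monoʳ-≤; +-monoˡ-≤; +-cancelʳ-≤;
           *-cancelˡ-≤; *-cancelʳ-≤; m^n≢0; module ≤-Reasoning;
           +-0-commutativeMonoid; *-1-commutativeMonoid)
  open import Data.Nat.Tactic.RingSolver using (solve-∀)
  open import Data.Vec.Functional using (Vector; head; tail)
  open import Data.Sum.Base using (inj₁; inj₂)
  open import Data.Product.Base using (_,_)
  open import Relation.Binary.PropositionalEquality using (_≡_; refl; sym; cong; cong₂; subst₂)
  open import Algebra.Properties.CommutativeMonoid.Sum +-0-commutativeMonoid using (sum)
  open import Algebra.Properties.CommutativeMonoid.Sum *-1-commutativeMonoid
    using () renaming (sum to product)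

  ^-distribʳ-* : ∀ m n k → (m * n) ^ k ≡ m ^ k * n ^ k
  ^-distribʳ-* m n zero    = refl
  ^-distribʳ-* m n (suc k) rewrite ^-distribʳ-* m n k = interchange m n (m ^ k) (n ^ k)
    where
    interchange : ∀ a b c d → (a * b) * (c * d) ≡ (a * c) * (b * d)
    interchange = solve-∀

  self-power-nonZero : ∀ n → NonZero (n ^ n)
  self-power-nonZero zero    = _
  self-power-nonZero (suc n) = m^n≢0 (suc n) (suc n)

  private
    square-expansion : ∀ x t → x * x + (x + t) * (x + t) ≡ 2 * ((x + t) * x) + t * t
    square-expansion = solve-∀

  2*-≤-sq+sq-ordered : ∀ {x a} → x ≤ a → 2 * (a * x) ≤ x * x + a * a
  2*-≤-sq+sq-ordered {x} x≤a with t , refl ← m≤n⇒∃[o]m+o≡n x≤a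
    rewrite square-expansion x t = m≤m+n _ (t * t)

  2*-≤-sq+sq : ∀ x a → 2 * (a * x) ≤ x * x + a * a
  2*-≤-sq+sq x a with ≤-total x a
  ... | inj₁ x≤a = 2*-≤-sq+sq-ordered x≤a
  ... | inj₂ a≤x = subst₂ _≤_ (cong (2 *_) (*-comm x a)) (+-comm (a * a) (x * x)) (2*-≤-sq+sq-ordered a≤x)

  -- x ^ (m + 1) lies above its tangent line at a
  pow-tangent : ∀ m a x → suc m * (a ^ m * x) ≤ x ^ suc m + m * a ^ suc m
  pow-tangent zero    a x = ≤-reflexive (unit-factors x)
    where
    unit-factors : ∀ x → 1 * (1 * x) ≡ x * 1 + 0
    unit-factors = solve-∀
  pow-tangent (suc m) a x = +-cancelʳ-≤ (m * (a * P * x)) _ _ (begin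
    (2 + m) * (a * P * x) + m * (a * P * x)              ≡⟨ regroup-lhs m a x P ⟩
    (1 + m) * P * (2 * (a * x))                          ≤⟨ *-monoʳ-≤ ((1 + m) * P) (2*-≤-sq+sq x a) ⟩
    (1 + m) * P * (x * x + a * a)                        ≡⟨ regroup-mid m a x P ⟩
    (1 + m) * (P * x) * x + (1 + m) * (a * (a * P))      ≤⟨ +-monoˡ-≤ ((1 + m) * (a * (a * P)))
                                                              (*-monoˡ-≤ x (pow-tangent m a x)) ⟩
    (x * X + m * (a * P)) * x + (1 + m) * (a * (a * P))  ≡⟨ regroup-rhs m a x P X ⟩
    (x * (x * X) + (1 + m) * (a * (a * P))) + m * (a * P * x) ∎)
    where
    open ≤-Reasoning
    P = a ^ m
    X = x ^ m
    regroup-lhs : ∀ m a x P → (2 + m) * (a * P * x) + m * (a * P * x) ≡ (1 + m) * P * (2 * (a * x))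
    regroup-lhs = solve-∀
    regroup-mid : ∀ m a x P → (1 + m) * P * (x * x + a * a) ≡ (1 + m) * (P * x) * x + (1 + m) * (a * (a * P))
    regroup-mid = solve-∀
    regroup-rhs : ∀ m a x P X →
      (x * X + m * (a * P)) * x + (1 + m) * (a * (a * P)) ≡ (x * (x * X) + (1 + m) * (a * (a * P))) + m * (a * P * x)
    regroup-rhs = solve-∀

  private
    split-product : ∀ k a T Q R →
      k * (a * R * ((1 + k) * Q)) + k * ((1 + k) * T * (Q * R)) ≡ (1 + k) * ((Q * R) * (k * (a + T)))
    split-product = solve-∀

    reassoc : ∀ a b c → a * b * c ≡ a * (c * b)
    reassoc = solve-∀

  -- multiplying by k makes the tangent point (1 + k) T / k integral
  amgm-step : ∀ a T k → a * T ^ k * suc k ^ suc k ≤ (a + T) ^ suc k * k ^ k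
  amgm-step a T zero      = *-monoˡ-≤ 1 (*-monoˡ-≤ 1 (m≤m+n a T))
  amgm-step a T k@(suc _) = *-cancelˡ-≤ k (+-cancelʳ-≤ c _ _ (begin
    k * (a * R * suc k ^ suc k) + c  ≡⟨ split-product k a T Q R ⟩
    suc k * ((Q * R) * x)            ≡⟨ cong (λ z → suc k * (z * x)) (sym Aᵏ) ⟩
    suc k * (A ^ k * x)              ≤⟨ pow-tangent k A x ⟩
    x ^ suc k + k * A ^ suc k        ≡⟨ cong₂ (λ u v → u + k * (A * v)) (^-distribʳ-* k (a + T) (suc k)) Aᵏ ⟩
    k * k ^ k * (a + T) ^ suc k + c  ≡⟨ cong (_+ c) (reassoc k (k ^ k) ((a + T) ^ suc k)) ⟩
    k * ((a + T) ^ suc k * k ^ k) + c ∎))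
    where
    open ≤-Reasoning
    A = suc k * T
    x = k * (a + T)
    Q = suc k ^ k
    R = T ^ k
    Aᵏ : A ^ k ≡ Q * R
    Aᵏ = ^-distribʳ-* (suc k) T k
    c = k * (A * (Q * R))

  amgm : ∀ n (w : Vector ℕ n) → product w * n ^ n ≤ sum w ^ n
  amgm zero    w = ≤-reflexive refl
  amgm (suc k) w = *-cancelʳ-≤ _ _ (k ^ k) {{self-power-nonZero k}} (begin
    a * P * suc k ^ suc k * k ^ k    ≡⟨ reorder a P (suc k ^ suc k) (k ^ k) ⟩
    a * (P * k ^ k) * suc k ^ suc k  ≤⟨ *-monoˡ-≤ (suc k ^ suc k) (*-monoʳ-≤ a (amgm k (tail w))) ⟩
    a * T ^ k * suc k ^ suc k        ≤⟨ amgm-step a T k ⟩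
    (a + T) ^ suc k * k ^ k          ∎)
    where
    open ≤-Reasoning
    a = head w
    P = product (tail w)
    T = sum (tail w)
    reorder : ∀ a p z q → a * p * z * q ≡ a * (p * q) * z
    reorder = solve-∀

module WeightedNorm where

  open import Data.Nat.Base as ℕ using (ℕ; zero; suc)
  import Data.Nat.Properties as ℕ
  open import Data.Fin.Base using (Fin; zero; suc; punchIn; punchOut)
  open import Data.Fin.Properties using (_≟_; punchInᵢ≢i; punchIn-punchOut; punchIn-injective)
  open import Data.Integer.Base using (+_; -_; _+_; _-_; _*_; ∣_∣)
  open import Data.Integer.Properties using (abs-*; ∣-i∣≡∣i∣)
  open import Data.List.Base using (List; []; _∷_; map; _++_; length)
  open import Data.List.Properties using (map-++; map-∘; map-cong)
  open import Data.List.Relation.Unary.All using (All; universal)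
  open import Data.List.Relation.Unary.All.Properties using (map⁺)
  import Data.List.Relation.Binary.Pointwise as Pointwise
  import Data.List.Relation.Binary.Pointwise.Properties as Pointwise
  open import Data.Vec.Functional using (Vector; head; tail; removeAt; updateAt)
  open import Data.Vec.Functional.Properties using (updateAt-updates; updateAt-minimal)
  open import Data.Bool.Base using (true; false; if_then_else_)
  open import Data.Sum.Base using (inj₁; inj₂)
  open import Data.Product.Base using (_,_)
  open import Function.Base using (_∘_)
  open import Relation.Nullary.Decidable using (yes; no; dec-true; dec-false)
  open import Relation.Binary.PropositionalEquality
    using (_≡_; _≢_; _≗_; refl; sym; trans; cong; cong₂; module ≡-Reasoning)
  open import Defs using (sgn; e)
  open Determinant
  open SubsetSum

  weightedNorm : (L N : ℕ) → Vector ℕ N → (Fin N → Row L) → ℕ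
  weightedNorm L N w M = subsetSum L N w (∣_∣ ∘ detRows L ∘ map M)

  weightedNorm-cong-rows : ∀ L N w {M M′ : Fin N → Row L} → M ≗ M′ →
    weightedNorm L N w M ≡ weightedNorm L N w M′
  weightedNorm-cong-rows L N w M≗M′ = subsetSum-cong L N w (cong (∣_∣ ∘ detRows L) ∘ map-cong M≗M′)

  map-map : ∀ {A B C : Set} (g : B → C) (f : A → B) xs → map g (map f xs) ≡ map (g ∘ f) xs
  map-map g f xs = sym (map-∘ xs)

  ∣sgn∣ : ∀ k → ∣ sgn k ∣ ≡ 1
  ∣sgn∣ zero    = refl
  ∣sgn∣ (suc k) = trans (∣-i∣≡∣i∣ (sgn k)) (∣sgn∣ k)

  abs-unit-* : ∀ σ x → ∣ σ ∣ ≡ 1 → ∣ σ * x ∣ ≡ ∣ x ∣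
  abs-unit-* σ x ∣σ∣≡1 =
    trans (abs-* σ x) (trans (cong (ℕ._* ∣ x ∣) ∣σ∣≡1) (ℕ.*-identityˡ ∣ x ∣))

  FirstColumnVanishesOff : ∀ {N L} → Fin N → (Fin N → Row (suc L)) → Set
  FirstColumnVanishesOff m M = ∀ j → j ≢ m → head (M j) ≡ + 0

  vanishing-rows : ∀ {N L} (M : Fin (suc N) → Row (suc L)) m → FirstColumnVanishesOff m M →
    ∀ J → All HeadZero (map M (map (punchIn m) J))
  vanishing-rows M m vanish J = map⁺ (map⁺ (universal (λ j → vanish (punchIn m j) (punchInᵢ≢i m j)) J))

  subsetSum-avoiding-vanishing-column : ∀ L N w (M : Fin (suc N) → Row (suc L)) m →
    FirstColumnVanishesOff m M → subsetSum (suc L) (suc N) w (avoiding m (∣_∣ ∘ detRows (suc L) ∘ map M)) ≡ 0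
  subsetSum-avoiding-vanishing-column L N w M m vanish = begin
    subsetSum (suc L) (suc N) w (avoiding m F)
      ≡⟨ subsetSum-avoiding (suc L) N w m F ⟩
    w m ℕ.* subsetSum (suc L) N (removeAt w m) (F ∘ map (punchIn m))
      ≡⟨ cong (w m ℕ.*_) (subsetSum-zero (suc L) N _ _ λ J →
           cong ∣_∣ (detRows-zero-column L _ (vanishing-rows M m vanish J))) ⟩
    w m ℕ.* 0
      ≡⟨ ℕ.*-zeroʳ (w m) ⟩
    0 ∎
    where
    open ≡-Reasoning
    F = ∣_∣ ∘ detRows (suc L) ∘ map M

  deletionOf-unit-column : ∀ {L N} (M : Fin (suc N) → Row (suc L)) m →
    FirstColumnVanishesOff m M → ∣ head (M m) ∣ ≡ 1 →
    DeletionOf m (∣_∣ ∘ detRows (suc L) ∘ map M) (∣_∣ ∘ detRows L ∘ map (tail ∘ removeAt M m))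
  deletionOf-unit-column {L} M m vanish unit A B = begin
    ∣ detRows (suc L) (map M (map (punchIn m) A ++ m ∷ map (punchIn m) B)) ∣
      ≡⟨ cong (∣_∣ ∘ detRows (suc L)) (map-++ M (map (punchIn m) A) (m ∷ map (punchIn m) B)) ⟩
    ∣ laplace L [] (above ++ M m ∷ below) ∣
      ≡⟨ cong ∣_∣ (laplace-single-nonzero L [] above (M m) below
                     (vanishing-rows M m vanish A) (vanishing-rows M m vanish B)) ⟩
    ∣ sgn (length above) * (head (M m) * detRows L (map tail above ++ map tail below)) ∣
      ≡⟨ trans (abs-unit-* (sgn (length above)) _ (∣sgn∣ (length above))) (abs-unit-* (head (M m)) _ unit) ⟩
    ∣ detRows L (map tail above ++ map tail below) ∣
      ≡⟨ cong (∣_∣ ∘ detRows L) (cong₂ _++_ (minors A) (minors B)) ⟩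
    ∣ detRows L (map M′ A ++ map M′ B) ∣
      ≡⟨ cong (∣_∣ ∘ detRows L) (sym (map-++ M′ A B)) ⟩
    ∣ detRows L (map M′ (A ++ B)) ∣ ∎
    where
    open ≡-Reasoning
    M′ = tail ∘ removeAt M m
    above = map M (map (punchIn m) A)
    below = map M (map (punchIn m) B)
    minors : ∀ X → map tail (map M (map (punchIn m) X)) ≡ map M′ X
    minors X = trans (map-map tail M _) (map-map (tail ∘ M) (punchIn m) X)

  weightedNorm-delete-row : ∀ L N w (M : Fin (suc N) → Row (suc L)) m →
    FirstColumnVanishesOff m M → ∣ head (M m) ∣ ≡ 1 →
    weightedNorm (suc L) (suc N) w M ≡ weightedNorm L N (removeAt w m) (tail ∘ removeAt M m)
  weightedNorm-delete-row L N w M m vanish unit = begin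
    weightedNorm (suc L) (suc N) w M
      ≡⟨ subsetSum-split (suc L) (suc N) w m F ⟩
    subsetSum (suc L) (suc N) w (containing m F) ℕ.+ subsetSum (suc L) (suc N) w (avoiding m F)
      ≡⟨ cong₂ ℕ._+_ (subsetSum-containing L N w m F _ (deletionOf-unit-column M m vanish unit))
                     (subsetSum-avoiding-vanishing-column L N w M m vanish) ⟩
    weightedNorm L N (removeAt w m) (tail ∘ removeAt M m) ℕ.+ 0
      ≡⟨ ℕ.+-identityʳ _ ⟩
    weightedNorm L N (removeAt w m) (tail ∘ removeAt M m) ∎
    where
    open ≡-Reasoning
    F = ∣_∣ ∘ detRows (suc L) ∘ map M

  e-same : ∀ {n} (m : Fin n) → e m m ≡ + 1
  e-same m = cong (if_then + 1 else + 0) (dec-true (m ≟ m) refl)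

  e-diff : ∀ {n} {m j : Fin n} → m ≢ j → e m j ≡ + 0
  e-diff {m = m} {j} m≢j = cong (if_then + 1 else + 0) (dec-false (m ≟ j) m≢j)

  addRow : ∀ {N L} → (Fin N → Row L) → Fin N → Fin N → Fin N → Row L
  addRow M a b = updateAt M a (_⊕ M b)

  addRow-addedOrKept : ∀ {N L} (M : Fin N → Row L) a b j → AddedOrKept (M b) (addRow M a b j) (M j)
  addRow-addedOrKept M a b j with j ≟ a
  ... | yes refl = inj₂ (updateAt-updates j M)
  ... | no j≢a   = inj₁ (updateAt-minimal j a M j≢a)

  detRows-addRow : ∀ {N L} (M : Fin N → Row L) a b → b ≢ a → ∀ I → b ∈ᵇ I ≡ true →
    detRows L (map (addRow M a b) I) ≡ detRows L (map M I)
  detRows-addRow {L = L} M a b b≢a I b∈I with P , Q , refl ← ∈ᵇ-split b I b∈I = begin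
    detRows L (map M⁺ (P ++ b ∷ Q))          ≡⟨ cong (detRows L) (map-++ M⁺ P (b ∷ Q)) ⟩
    detRows L (map M⁺ P ++ M⁺ b ∷ map M⁺ Q)  ≡⟨ cong (λ r → detRows L (map M⁺ P ++ r ∷ map M⁺ Q))
                                                    (updateAt-minimal b a M b≢a) ⟩
    detRows L (map M⁺ P ++ M b ∷ map M⁺ Q)   ≡⟨ detRows-add-to-other-rows L (M b) (added P) (added Q) ⟩
    detRows L (map M P ++ M b ∷ map M Q)     ≡⟨ cong (detRows L) (map-++ M P (b ∷ Q)) ⟨
    detRows L (map M (P ++ b ∷ Q))           ∎
    where
    open ≡-Reasoning
    M⁺ = addRow M a b
    added : ∀ X → Pointwise.Pointwise (AddedOrKept (M b)) (map M⁺ X) (map M X)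
    added X = Pointwise.map⁺ _ _ (Pointwise.refl (λ {j} → addRow-addedOrKept M a b j))

  weightedNorm-contract : ∀ L N w (M : Fin (suc (suc N)) → Row (suc L)) a b (b≢a : b ≢ a) →
    (∀ j → head (M j) ≡ e a j - e b j) →
    weightedNorm (suc L) (suc (suc N)) w M
      ≡ weightedNorm L (suc N) (updateAt (removeAt w b) (punchOut b≢a) (ℕ._+ w b))
                     (tail ∘ removeAt (addRow M a b) b)
  weightedNorm-contract L N w M a b b≢a column = begin
    weightedNorm (suc L) (suc (suc N)) w M
      ≡⟨ subsetSum-split (suc L) (suc (suc N)) w b F ⟩
    subsetSum (suc L) (suc (suc N)) w (containing b F) ℕ.+ subsetSum (suc L) (suc (suc N)) w (avoiding b F)
      ≡⟨ cong₂ ℕ._+_ containing-part avoiding-part ⟩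
    weightedNorm L (suc N) (removeAt w b) M′ ℕ.+ w b ℕ.* subsetSum L N w″ (F′ ∘ map (punchIn a′))
      ≡⟨ sym (subsetSum-increase-weight L N (removeAt w b) a′ (w b) F′) ⟩
    weightedNorm L (suc N) (updateAt (removeAt w b) a′ (ℕ._+ w b)) M′ ∎
    where
    open ≡-Reasoning
    a′ = punchOut b≢a
    w″ = removeAt (removeAt w b) a′
    M⁺ = addRow M a b
    M′ = tail ∘ removeAt M⁺ b
    F = ∣_∣ ∘ detRows (suc L) ∘ map M
    F′ = ∣_∣ ∘ detRows L ∘ map M′
    punchIn-a′ : punchIn b a′ ≡ a
    punchIn-a′ = punchIn-punchOut b≢a
    punchIn≢a : ∀ j → j ≢ a′ → punchIn b j ≢ a
    punchIn≢a j j≢a′ eq = j≢a′ (punchIn-injective b j a′ (trans eq (sym punchIn-a′)))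

    column-off : ∀ j → j ≢ a → j ≢ b → head (M j) ≡ + 0
    column-off j j≢a j≢b = trans (column j) (cong₂ _-_ (e-diff (j≢a ∘ sym)) (e-diff (j≢b ∘ sym)))
    column-at-a : head (M a) ≡ + 1
    column-at-a = trans (column a) (cong₂ _-_ (e-same a) (e-diff b≢a))
    column-at-b : head (M b) ≡ - + 1
    column-at-b = trans (column b) (cong₂ _-_ (e-diff (b≢a ∘ sym)) (e-same b))

    vanish⁺ : FirstColumnVanishesOff b M⁺
    vanish⁺ j j≢b with j ≟ a
    ... | yes refl = trans (cong head (updateAt-updates j M)) (cong₂ _+_ column-at-a column-at-b)
    ... | no j≢a   = trans (cong head (updateAt-minimal j a M j≢a)) (column-off j j≢a j≢b)
    unit⁺ : ∣ head (M⁺ b) ∣ ≡ 1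
    unit⁺ = cong ∣_∣ (trans (cong head (updateAt-minimal b a M b≢a)) column-at-b)
    containing-part : subsetSum (suc L) (suc (suc N)) w (containing b F) ≡ weightedNorm L (suc N) (removeAt w b) M′
    containing-part = trans
      (subsetSum-cong (suc L) (suc (suc N)) w same-on-members)
      (subsetSum-containing L (suc N) w b (∣_∣ ∘ detRows (suc L) ∘ map M⁺) F′
        (deletionOf-unit-column M⁺ b vanish⁺ unit⁺))
      where
      same-on-members : ∀ I → containing b F I ≡ containing b (∣_∣ ∘ detRows (suc L) ∘ map M⁺) I
      same-on-members I with b ∈ᵇ I in b∈I
      ... | true  = cong ∣_∣ (sym (detRows-addRow M a b b≢a I b∈I))
      ... | false = refl

    vanish′ : FirstColumnVanishesOff a′ (removeAt M b)
    vanish′ j j≢a′ = column-off (punchIn b j) (punchIn≢a j j≢a′) (punchInᵢ≢i b j)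
    unit′ : ∣ head (removeAt M b a′) ∣ ≡ 1
    unit′ = cong ∣_∣ (trans (cong (head ∘ M) punchIn-a′) column-at-a)
    avoiding-part : subsetSum (suc L) (suc (suc N)) w (avoiding b F)
                  ≡ w b ℕ.* subsetSum L N w″ (F′ ∘ map (punchIn a′))
    avoiding-part = begin
      subsetSum (suc L) (suc (suc N)) w (avoiding b F)
        ≡⟨ subsetSum-avoiding (suc L) (suc N) w b F ⟩
      w b ℕ.* subsetSum (suc L) (suc N) (removeAt w b) (F ∘ map (punchIn b))
        ≡⟨ cong (w b ℕ.*_) (subsetSum-cong (suc L) (suc N) (removeAt w b)
                              (cong (∣_∣ ∘ detRows (suc L)) ∘ map-map M (punchIn b))) ⟩
      w b ℕ.* weightedNorm (suc L) (suc N) (removeAt w b) (removeAt M b)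
        ≡⟨ cong (w b ℕ.*_) (weightedNorm-delete-row L N (removeAt w b) (removeAt M b) a′ vanish′ unit′) ⟩
      w b ℕ.* weightedNorm L N w″ (tail ∘ removeAt (removeAt M b) a′)
        ≡⟨ cong (w b ℕ.*_) (weightedNorm-cong-rows L N w″ untouched) ⟩
      w b ℕ.* weightedNorm L N w″ (M′ ∘ punchIn a′)
        ≡⟨ cong (w b ℕ.*_) (subsetSum-cong L N w″ (cong (∣_∣ ∘ detRows L) ∘ sym ∘ map-map M′ (punchIn a′))) ⟩
      w b ℕ.* subsetSum L N w″ (F′ ∘ map (punchIn a′)) ∎
      where
      untouched : tail ∘ removeAt (removeAt M b) a′ ≗ M′ ∘ punchIn a′
      untouched i = cong tail (sym (updateAt-minimal _ a M (punchIn≢a (punchIn a′ i) (punchInᵢ≢i a′ i))))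

module AdmissibleColumns where

  open import Data.Nat.Base using (zero; suc)
  open import Data.Fin.Base using (Fin; zero; suc; punchIn; punchOut)
  open import Data.Fin.Properties using (_≟_; punchInᵢ≢i; punchIn-punchOut; punchIn-injective)
  open import Data.Integer.Base using (ℤ; +_; -_; _+_; _-_)
  open import Data.Integer.Properties using (+-identityˡ; +-identityʳ)
  open import Data.Integer.Tactic.RingSolver using (solve-∀)
  open import Data.Maybe.Base using (Maybe; just; nothing)
  open import Data.Vec.Functional using (Vector; tail; removeAt)
  open import Data.Vec.Functional.Properties using (updateAt-updates; updateAt-minimal)
  open import Data.Sum.Base using (_⊎_; inj₁; inj₂)
  open import Data.Product.Base using (Σ; _,_)
  open import Function.Base using (_∘_)
  open import Relation.Nullary.Decidable using (yes; no)
  open import Relation.Binary.PropositionalEquality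
    using (_≡_; _≢_; refl; sym; trans; cong; cong₂; module ≡-Reasoning)
  open import Defs using (e; InE; InF)
  open Determinant using (Row)
  open WeightedNorm using (e-same; e-diff; addRow)

  e? : ∀ {n} → Maybe (Fin n) → Fin n → ℤ
  e? nothing  j = + 0
  e? (just m) j = e m j

  -- covers E_N, F_N and the zero vector, and is stable under the two reductions
  BasisDifference : ∀ {n} → Vector ℤ n → Set
  BasisDifference {n} v = Σ (Maybe (Fin n)) λ p → Σ (Maybe (Fin n)) λ q → ∀ j → v j ≡ e? p j - e? q j

  AdmissibleRows : ∀ {N L} → (Fin N → Row L) → Set
  AdmissibleRows M = ∀ c → BasisDifference (λ j → M j c)

  e-punchIn : ∀ {n} (m : Fin (suc n)) x j → e (punchIn m x) (punchIn m j) ≡ e x j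
  e-punchIn m x j with x ≟ j
  ... | yes refl = e-same (punchIn m x)
  ... | no x≢j   = e-diff (x≢j ∘ punchIn-injective m x j)

  e-punchOut : ∀ {n} {m x : Fin (suc n)} (m≢x : m ≢ x) j → e x (punchIn m j) ≡ e (punchOut m≢x) j
  e-punchOut {m = m} m≢x j = trans (cong (λ y → e y (punchIn m j)) (sym (punchIn-punchOut m≢x))) (e-punchIn m _ j)

  deleteIndex : ∀ {n} → Fin (suc n) → Maybe (Fin (suc n)) → Maybe (Fin n)
  deleteIndex m nothing  = nothing
  deleteIndex m (just x) with m ≟ x
  ... | yes _   = nothing
  ... | no m≢x  = just (punchOut m≢x)

  e?-deleteIndex : ∀ {n} (m : Fin (suc n)) p j → e? p (punchIn m j) ≡ e? (deleteIndex m p) j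
  e?-deleteIndex m nothing  j = refl
  e?-deleteIndex m (just x) j with m ≟ x
  ... | yes refl = e-diff (punchInᵢ≢i m j ∘ sym)
  ... | no m≢x   = e-punchOut m≢x j

  admissible-delete-row : ∀ {N L} (M : Fin (suc N) → Row (suc L)) m →
    AdmissibleRows M → AdmissibleRows (tail ∘ removeAt M m)
  admissible-delete-row M m admissible c with p , q , column ← admissible (suc c) =
    deleteIndex m p , deleteIndex m q ,
    λ j → trans (column (punchIn m j)) (cong₂ _-_ (e?-deleteIndex m p j) (e?-deleteIndex m q j))

  -- index b is merged into a
  mergeIndex : ∀ {n} {a b : Fin (suc n)} → b ≢ a → Maybe (Fin (suc n)) → Maybe (Fin n)
  mergeIndex b≢a nothing  = nothing
  mergeIndex {b = b} b≢a (just x) with b ≟ x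
  ... | yes _   = just (punchOut b≢a)
  ... | no b≢x  = just (punchOut b≢x)

  e?-mergeIndex-merged : ∀ {n} {a b : Fin (suc n)} (b≢a : b ≢ a) p i → punchIn b i ≡ a →
    e? p (punchIn b i) + e? p b ≡ e? (mergeIndex b≢a p) i
  e?-mergeIndex-merged         b≢a nothing  i _ = refl
  e?-mergeIndex-merged {b = b} b≢a (just x) i punchIn≡a with b ≟ x
  ... | yes refl rewrite punchIn≡a | e-diff b≢a | e-same b =
    sym (trans (cong (e (punchOut b≢a)) i≡a′) (e-same (punchOut b≢a)))
    where
    i≡a′ : i ≡ punchOut b≢a
    i≡a′ = punchIn-injective b i _ (trans punchIn≡a (sym (punchIn-punchOut b≢a)))
  ... | no b≢x rewrite e-diff (b≢x ∘ sym) = trans (+-identityʳ _) (e-punchOut b≢x i)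

  e?-mergeIndex-kept : ∀ {n} {a b : Fin (suc n)} (b≢a : b ≢ a) p i → punchIn b i ≢ a →
    e? p (punchIn b i) ≡ e? (mergeIndex b≢a p) i
  e?-mergeIndex-kept         b≢a nothing  i _ = refl
  e?-mergeIndex-kept {b = b} b≢a (just x) i punchIn≢a with b ≟ x
  ... | yes refl = trans (e-diff (punchInᵢ≢i b i ∘ sym))
                         (sym (e-diff λ a′≡i → punchIn≢a
                           (trans (cong (punchIn b) (sym a′≡i)) (punchIn-punchOut b≢a))))
  ... | no b≢x   = e-punchOut b≢x i

  admissible-contract : ∀ {N L} (M : Fin (suc N) → Row (suc L)) a b (b≢a : b ≢ a) →
    AdmissibleRows M → AdmissibleRows (tail ∘ removeAt (addRow M a b) b)
  admissible-contract M a b b≢a admissible c with p , q , column ← admissible (suc c) =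
    mergeIndex b≢a p , mergeIndex b≢a q , merged-column
    where
    merged-column : ∀ i → addRow M a b (punchIn b i) (suc c) ≡ e? (mergeIndex b≢a p) i - e? (mergeIndex b≢a q) i
    merged-column i with punchIn b i ≟ a
    ... | yes refl = begin
      addRow M a b (punchIn b i) (suc c)   ≡⟨ cong (λ r → r (suc c)) (updateAt-updates (punchIn b i) M) ⟩
      M (punchIn b i) (suc c) + M b (suc c) ≡⟨ cong₂ _+_ (column (punchIn b i)) (column b) ⟩
      (e? p (punchIn b i) - e? q (punchIn b i)) + (e? p b - e? q b)
        ≡⟨ interchange (e? p (punchIn b i)) (e? q (punchIn b i)) (e? p b) (e? q b) ⟩
      (e? p (punchIn b i) + e? p b) - (e? q (punchIn b i) + e? q b)
        ≡⟨ cong₂ _-_ (e?-mergeIndex-merged b≢a p i refl) (e?-mergeIndex-merged b≢a q i refl) ⟩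
      e? (mergeIndex b≢a p) i - e? (mergeIndex b≢a q) i ∎
      where
      open ≡-Reasoning
      interchange : ∀ (x y z t : ℤ) → (x - y) + (z - t) ≡ (x + z) - (y + t)
      interchange = solve-∀
    ... | no punchIn≢a = trans (cong (λ r → r (suc c)) (updateAt-minimal (punchIn b i) a M punchIn≢a))
      (trans (column (punchIn b i))
             (cong₂ _-_ (e?-mergeIndex-kept b≢a p i punchIn≢a) (e?-mergeIndex-kept b≢a q i punchIn≢a)))

  inE⊎inF⇒basisDifference : ∀ {N} {v : Fin N → ℤ} → InE v ⊎ InF v → BasisDifference v
  inE⊎inF⇒basisDifference (inj₁ (m , inj₁ v≡e))      =
    just m , nothing , λ j → trans (v≡e j) (sym (+-identityʳ (e m j)))
  inE⊎inF⇒basisDifference (inj₁ (m , inj₂ v≡-e))     =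
    nothing , just m , λ j → trans (v≡-e j) (sym (+-identityˡ (- e m j)))
  inE⊎inF⇒basisDifference (inj₂ (m , n , _ , v≡e-e)) = just m , just n , v≡e-e

module Induction where

  open import Data.Nat.Base as ℕ using (ℕ; zero; suc; _∸_; _^_; s≤s)
  import Data.Nat.Properties as ℕ
  open import Data.Fin.Base using (Fin; zero; suc; punchOut)
  open import Data.Fin.Properties using (_≟_)
  open import Data.Integer.Base using (+_; -_; _-_; ∣_∣)
  open import Data.Integer.Properties using (∣-i∣≡∣i∣; ∣i∣≡0⇒i≡0; +-identityˡ; +-identityʳ; +-inverseʳ)
  open import Data.Maybe.Base using (just; nothing)
  open import Data.List.Base using (map)
  open import Data.List.Relation.Unary.All using (universal)
  open import Data.List.Relation.Unary.All.Properties using (map⁺)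
  open import Data.Vec.Functional using (Vector; head; tail; removeAt; updateAt)
  open import Data.Product.Base using (_,_)
  open import Data.Empty using (⊥-elim)
  open import Function.Base using (_∘_)
  open import Relation.Nullary.Decidable using (yes; no)
  open import Relation.Binary.PropositionalEquality using (_≡_; _≢_; refl; sym; trans; cong)
  open import Algebra.Properties.CommutativeMonoid.Sum ℕ.+-0-commutativeMonoid using (sum; sum-remove)
  open import Algebra.Properties.CommutativeMonoid.Sum ℕ.*-1-commutativeMonoid using () renaming (sum to product)
  open import Defs using (e)
  open Determinant using (Row; detRows; detRows-zero-column)
  open SubsetSum using (subsetSum-zero)
  open AMGM using (amgm)
  open WeightedNorm
    using (weightedNorm; weightedNorm-delete-row; weightedNorm-contract; FirstColumnVanishesOff; e-same; e-diff; addRow)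
  open AdmissibleColumns using (AdmissibleRows; admissible-delete-row; admissible-contract)

  sum-updateAt-+ : ∀ {n} (w : Vector ℕ n) i d → sum (updateAt w i (ℕ._+ d)) ≡ sum w ℕ.+ d
  sum-updateAt-+ w zero    d = reassoc (head w) d (sum (tail w))
    where
    reassoc : ∀ x d s → (x ℕ.+ d) ℕ.+ s ≡ (x ℕ.+ s) ℕ.+ d
    reassoc x d s = trans (ℕ.+-assoc x d s) (trans (cong (x ℕ.+_) (ℕ.+-comm d s)) (sym (ℕ.+-assoc x s d)))
  sum-updateAt-+ w (suc i) d =
    trans (cong (head w ℕ.+_) (sum-updateAt-+ (tail w) i d)) (sym (ℕ.+-assoc (head w) (sum (tail w)) d))

  sum-merge : ∀ {n} (w : Vector ℕ (suc n)) b i → sum (updateAt (removeAt w b) i (ℕ._+ w b)) ≡ sum w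
  sum-merge w b i =
    trans (sum-updateAt-+ (removeAt w b) i (w b)) (trans (ℕ.+-comm _ (w b)) (sym (sum-remove w)))

  sum-removeAt-≤ : ∀ {n} (w : Vector ℕ (suc n)) m → sum (removeAt w m) ℕ.≤ sum w
  sum-removeAt-≤ w m = ℕ.≤-trans (ℕ.m≤n+m _ (w m)) (ℕ.≤-reflexive (sym (sum-remove w)))

  Bound : (L N : ℕ) → Vector ℕ N → (Fin N → Row L) → Set
  Bound L N w M = weightedNorm L N w M ℕ.* (N ∸ L) ^ (N ∸ L) ℕ.≤ sum w ^ (N ∸ L)

  bound-no-rows : ∀ N w (M : Fin N → Row 0) → Bound 0 N w M
  bound-no-rows N w M = ℕ.≤-trans (ℕ.≤-reflexive (cong (ℕ._* (N ^ N)) (ℕ.*-identityˡ (product w)))) (amgm N w)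

  bound-zero-column : ∀ L N w (M : Fin N → Row (suc L)) → (∀ j → head (M j) ≡ + 0) → Bound (suc L) N w M
  bound-zero-column L N w M column rewrite subsetSum-zero (suc L) N w (∣_∣ ∘ detRows (suc L) ∘ map M)
    (λ I → cong ∣_∣ (detRows-zero-column L (map M I) (map⁺ (universal column I))))
    = ℕ.z≤n

  ∣i-0∣≡∣i∣ : ∀ i → ∣ i - + 0 ∣ ≡ ∣ i ∣
  ∣i-0∣≡∣i∣ i = cong ∣_∣ (+-identityʳ i)

  ∣0-i∣≡∣i∣ : ∀ i → ∣ + 0 - i ∣ ≡ ∣ i ∣
  ∣0-i∣≡∣i∣ i = trans (cong ∣_∣ (+-identityˡ (- i))) (∣-i∣≡∣i∣ i)

  bound-delete-row : ∀ L N w (M : Fin (suc N) → Row (suc L)) m → (∀ j → ∣ head (M j) ∣ ≡ ∣ e m j ∣) →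
    Bound L N (removeAt w m) (tail ∘ removeAt M m) → Bound (suc L) (suc N) w M
  bound-delete-row L N w M m column bound = ℕ.≤-trans
    (ℕ.≤-reflexive (cong (ℕ._* ((N ∸ L) ^ (N ∸ L))) (weightedNorm-delete-row L N w M m vanish unit)))
    (ℕ.≤-trans bound (ℕ.^-monoˡ-≤ (N ∸ L) (sum-removeAt-≤ w m)))
    where
    vanish : FirstColumnVanishesOff m M
    vanish j j≢m = ∣i∣≡0⇒i≡0 (trans (column j) (cong ∣_∣ (e-diff (j≢m ∘ sym))))
    unit : ∣ head (M m) ∣ ≡ 1
    unit = trans (column m) (cong ∣_∣ (e-same m))

  bound-contract : ∀ L N w (M : Fin (suc N) → Row (suc L)) a b (b≢a : b ≢ a) →
    (∀ j → head (M j) ≡ e a j - e b j) →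
    Bound L N (updateAt (removeAt w b) (punchOut b≢a) (ℕ._+ w b)) (tail ∘ removeAt (addRow M a b) b) →
    Bound (suc L) (suc N) w M
  bound-contract L zero    w M zero zero b≢a column bound = ⊥-elim (b≢a refl)
  bound-contract L (suc N) w M a    b    b≢a column bound
    rewrite weightedNorm-contract L N w M a b b≢a column | sym (sum-merge w b (punchOut b≢a))
    = bound

  weightedNorm-bound : ∀ L N w (M : Fin N → Row L) → AdmissibleRows M → L ℕ.≤ N → Bound L N w M
  weightedNorm-bound zero    N       w M _          _         = bound-no-rows N w M
  weightedNorm-bound (suc L) (suc N) w M admissible (s≤s L≤N) with admissible zero
  ... | nothing , nothing , column = bound-zero-column L (suc N) w M column
  ... | just m  , nothing , column = bound-delete-row L N w M m (λ j → trans (cong ∣_∣ (column j)) (∣i-0∣≡∣i∣ (e m j)))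
    (weightedNorm-bound L N _ _ (admissible-delete-row M m admissible) L≤N)
  ... | nothing , just m  , column = bound-delete-row L N w M m (λ j → trans (cong ∣_∣ (column j)) (∣0-i∣≡∣i∣ (e m j)))
    (weightedNorm-bound L N _ _ (admissible-delete-row M m admissible) L≤N)
  ... | just a  , just b  , column with b ≟ a
  ...   | yes refl = bound-zero-column L (suc N) w M (λ j → trans (column j) (+-inverseʳ (e a j)))
  ...   | no b≢a   = bound-contract L N w M a b b≢a column
    (weightedNorm-bound L N _ _ (admissible-contract M a b b≢a admissible) L≤N)

module Correspondence where

  open import Data.Nat.Base as ℕ using (ℕ; zero; suc)
  open import Data.Nat.Properties as ℕ using (+-0-commutativeMonoid; *-1-commutativeMonoid)
  open import Algebra.Properties.CommutativeMonoid.Sum +-0-commutativeMonoid using () renaming (sum to ∑)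
  open import Data.Fin.Base using (Fin; zero; suc; toℕ)
  open import Data.Integer.Base using (ℤ; +_; -_; _+_; _-_; _*_; ∣_∣)
  open import Data.Integer.Properties using (neg-distrib-+)
  open import Data.Integer.Tactic.RingSolver using (solve-∀)
  open import Data.List.Base using (List; []; _∷_; [_]; map; _++_; tabulate)
  open import Data.List.Properties using (map-++; map-cong; map-∘; map-tabulate)
  open import Data.Nat.ListAction using (sum)
  open import Data.Nat.ListAction.Properties using (sum-++)
  open import Data.Vec.Base using (Vec; lookup; toList)
  import Data.Vec.Base as Vec
  open import Data.Vec.Properties using (toList-map)
  open import Data.Vec.Functional using (tail; removeAt)
  open import Function.Base using (_∘_)
  open import Relation.Binary.PropositionalEquality
    using (_≡_; _≗_; refl; sym; trans; cong; cong₂; module ≡-Reasoning)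
  open import Algebra.Properties.CommutativeMonoid.Sum *-1-commutativeMonoid
    using () renaming (sum-replicate-zero to product-ones)
  open import Defs using (sumFin; sgn; det; combs; wedgeNorm1)
  open WeightedNorm using (weightedNorm)
  open Determinant
  open SubsetSum using (subsetSum)

  sumFin-cong : ∀ m {f g : Fin m → ℤ} → f ≗ g → sumFin m f ≡ sumFin m g
  sumFin-cong zero    f≗g = refl
  sumFin-cong (suc m) f≗g = cong₂ _+_ (f≗g zero) (sumFin-cong m (f≗g ∘ suc))

  sumFin-neg : ∀ m f → sumFin m (λ i → - f i) ≡ - sumFin m f
  sumFin-neg zero    f = refl
  sumFin-neg (suc m) f rewrite sumFin-neg m (f ∘ suc) = sym (neg-distrib-+ (f zero) (sumFin m (f ∘ suc)))

  private
    first-term : ∀ (h d : ℤ) → + 1 * h * d + + 0 ≡ h * d - + 0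
    first-term = solve-∀

    negate-term : ∀ (σ h d : ℤ) → (- σ) * h * d ≡ - (σ * h * d)
    negate-term = solve-∀

    split-first-term : ∀ (h d x : ℤ) → + 1 * h * d + - x ≡ h * d - x
    split-first-term = solve-∀

  laplace-as-sumFin : ∀ n m (done : List (Row n)) (B : Fin (suc m) → Row (suc n)) →
    sumFin (suc m) (λ i → sgn (toℕ i) * B i zero * detRows n (done ++ map tail (tabulate (removeAt B i))))
      ≡ laplace n done (tabulate B)
  laplace-as-sumFin n zero    done B = first-term (B zero zero) (detRows n (done ++ []))
  laplace-as-sumFin n (suc m) done B = begin
    h₀ + sumFin (suc m) (λ i → sgn (toℕ (suc i)) * B (suc i) zero * detRows n (done ++ tail (B zero) ∷ minors i))
      ≡⟨ cong (λ t → h₀ + t) (sumFin-cong (suc m) λ i →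
           trans (negate-term (sgn (toℕ i)) (B (suc i) zero) _)
                 (cong (λ rows → - (sgn (toℕ i) * B (suc i) zero * detRows n rows))
                       (sym (++-snoc done (tail (B zero)) (minors i))))) ⟩
    h₀ + sumFin (suc m) (λ i → - (sgn (toℕ i) * B (suc i) zero * detRows n (done′ ++ minors i)))
      ≡⟨ cong (λ t → h₀ + t)
           (trans (sumFin-neg (suc m) λ i → sgn (toℕ i) * B (suc i) zero * detRows n (done′ ++ minors i))
                                    (cong -_ (laplace-as-sumFin n m done′ (tail B)))) ⟩
    h₀ + - laplace n done′ (tabulate (tail B))
      ≡⟨ split-first-term (B zero zero) (detRows n (done ++ map tail (tabulate (tail B)))) _ ⟩
    laplace n done (tabulate B) ∎
    where
    open ≡-Reasoning
    h₀ = + 1 * B zero zero * detRows n (done ++ map tail (tabulate (tail B)))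
    done′ = done ++ [ tail (B zero) ]
    minors : Fin (suc m) → List (Row n)
    minors i = map tail (tabulate (removeAt (tail B) i))

  det≡detRows : ∀ n A → det n A ≡ detRows n (tabulate A)
  det≡detRows zero    A = refl
  det≡detRows (suc n) A = trans
    (sumFin-cong (suc n) λ i → cong (sgn (toℕ i) * A i zero *_)
      (trans (det≡detRows n _) (cong (detRows n) (sym (map-tabulate (removeAt A i) tail)))))
    (laplace-as-sumFin n n [] A)

  tabulate-lookup-map : ∀ {A : Set} {k n} (f : Fin n → A) (I : Vec (Fin n) k) →
    tabulate (f ∘ lookup I) ≡ map f (toList I)
  tabulate-lookup-map f Vec.[]      = refl
  tabulate-lookup-map f (i Vec.∷ I) = cong (f i ∷_) (tabulate-lookup-map f I)

  sum-map-map : ∀ {A B : Set} (g : B → ℕ) (f : A → B) {h : A → ℕ} → (∀ x → g (f x) ≡ h x) →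
    ∀ xs → sum (map g (map f xs)) ≡ sum (map h xs)
  sum-map-map g f g∘f≗h xs = cong sum (trans (sym (map-∘ xs)) (map-cong g∘f≗h xs))

  sum-map-combs : ∀ k n (F : List (Fin n) → ℕ) →
    sum (map (F ∘ toList) (combs k n)) ≡ subsetSum k n (λ _ → 1) F
  sum-map-combs zero    n       F =
    trans (ℕ.+-identityʳ (F [])) (sym (trans (cong (F [] ℕ.*_) (product-ones n)) (ℕ.*-identityʳ (F []))))
  sum-map-combs (suc k) zero    F = refl
  sum-map-combs (suc k) (suc n) F = begin
    sum (map (F ∘ toList) (map with-zero C₀ ++ map shift C₁))
      ≡⟨ cong sum (map-++ (F ∘ toList) (map with-zero C₀) (map shift C₁)) ⟩
    sum (map (F ∘ toList) (map with-zero C₀) ++ map (F ∘ toList) (map shift C₁))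
      ≡⟨ sum-++ (map (F ∘ toList) (map with-zero C₀)) _ ⟩
    sum (map (F ∘ toList) (map with-zero C₀)) ℕ.+ sum (map (F ∘ toList) (map shift C₁))
      ≡⟨ cong₂ ℕ._+_ (sum-map-map (F ∘ toList) with-zero (cong (F ∘ (zero ∷_)) ∘ toList-map suc) C₀)
                     (sum-map-map (F ∘ toList) shift (cong F ∘ toList-map suc) C₁) ⟩
    sum (map (F₀ ∘ toList) C₀) ℕ.+ sum (map (F₁ ∘ toList) C₁)
      ≡⟨ cong₂ ℕ._+_ (sum-map-combs k n F₀) (sum-map-combs (suc k) n F₁) ⟩
    subsetSum k n _ F₀ ℕ.+ subsetSum (suc k) n _ F₁
      ≡⟨ cong (subsetSum k n _ F₀ ℕ.+_) (ℕ.+-identityʳ _) ⟨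
    subsetSum (suc k) (suc n) (λ _ → 1) F ∎
    where
    open ≡-Reasoning
    C₀ = combs k n
    C₁ = combs (suc k) n
    F₀ = F ∘ (zero ∷_) ∘ map suc
    F₁ = F ∘ map suc
    with-zero : Vec (Fin n) k → Vec (Fin (suc n)) (suc k)
    with-zero v = zero Vec.∷ Vec.map suc v
    shift : Vec (Fin n) (suc k) → Vec (Fin (suc n)) (suc k)
    shift = Vec.map suc

  wedgeNorm1≡weightedNorm : ∀ N L (ξ : Fin L → Fin N → ℤ) →
    wedgeNorm1 N L ξ ≡ weightedNorm L N (λ _ → 1) (λ j c → ξ c j)
  wedgeNorm1≡weightedNorm N L ξ = trans
    (cong sum (map-cong (λ I → cong ∣_∣ (trans (det≡detRows L _) (cong (detRows L) (tabulate-lookup-map rows I))))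
                        (combs L N)))
    (sum-map-combs L N (∣_∣ ∘ detRows L ∘ map rows))
    where
    rows : Fin N → Row L
    rows j c = ξ c j

  ∑-ones : ∀ n → ∑ {n} (λ _ → 1) ≡ n
  ∑-ones zero    = refl
  ∑-ones (suc n) = cong suc (∑-ones n)

open import Defs
open import Data.Nat using (ℕ; _<_; _≤_; _*_; _∸_; _^_)
open import Data.Fin using (Fin)
open import Data.Integer using (ℤ)
open import Data.Sum using (_⊎_)

open import Data.Nat.Properties using (<⇒≤)
open import Function.Base using (_∘_)
open import Relation.Binary.PropositionalEquality using (sym; subst₂)
open AdmissibleColumns using (inE⊎inF⇒basisDifference)
open Induction using (weightedNorm-bound)
open Correspondence using (wedgeNorm1≡weightedNorm; ∑-ones)

lemma3p10 : (L N : ℕ) → 0 < L → L < N → N ≤ 2 * L →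
    (ξ : Fin L → Fin N → ℤ) → (∀ ℓ → InE (ξ ℓ) ⊎ InF (ξ ℓ)) →
    wedgeNorm1 N L ξ * (N ∸ L) ^ (N ∸ L) ≤ N ^ (N ∸ L)
lemma3p10 L N _ L<N _ ξ columns =
  subst₂ (λ norm total → norm * (N ∸ L) ^ (N ∸ L) ≤ total ^ (N ∸ L))
    (sym (wedgeNorm1≡weightedNorm N L ξ)) (∑-ones N)
    (weightedNorm-bound L N (λ _ → 1) (λ j c → ξ c j) (inE⊎inF⇒basisDifference ∘ columns) (<⇒≤ L<N))
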